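{- In LLFP (defined in the context): (1) if $\Gamma \vdash_\Sigma K$ then $K$ is strongly normalizing with respect to $\to_{\beta\mathcal{L}}$; (2) if $\Gamma \vdash_\Sigma \sigma : K$ then $\sigma$ is strongly normalizing with respect to $\to_{\beta\mathcal{L}}$; (3) if $\Gamma \vdash_\Sigma M : \sigma$ then $M$ is strongly normalizing with respect to $\to_{\beta\mathcal{L}}$.
   Context: LLFP (Lax Logical Framework) is parametrized by a set of predicates $\mathcal{P}$ on typing judgements $\Gamma \vdash_\Sigma N:\sigma$. Pseudo-syntax: signatures $\Sigma ::= \emptyset \mid \Sigma, a:K \mid \Sigma, c:\sigma$; contexts $\Gamma ::= \emptyset \mid \Gamma, x:\sigma$; kinds $K ::= \mathrm{Type} \mid \Pi x{:}\sigma.K$; families $\sigma,\tau,\rho ::= a \mid \Pi x{:}\sigma.\tau \mid \sigma N \mid \mathcal{L}^{\mathcal{P}}_{N,\sigma}[\rho]$; objects $M,N ::= c \mid x \mid \lambda x{:}\sigma.M \mid M N \mid \mathcal{L}^{\mathcal{P}}_{N,\sigma}[M] \mid \mathcal{U}^{\mathcal{P}}_{N,\sigma}[M]$. One-step $\beta\mathcal{L}$-reduction $\to_{\beta\mathcal{L}}$ is the closure under all constructors (all argument positions) of $(\lambda x{:}\sigma.M)N \to M[N/x]$ and $\mathcal{U}^{\mathcal{P}}_{N,\sigma}[\mathcal{L}^{\mathcal{P}}_{N,\sigma}[M]] \to M$; $=_{\beta\mathcal{L}}$ is its reflexive, symmetric, transitive closure. Judgements: $\Sigma\ \mathrm{sig}$,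 $\vdash_\Sigma \Gamma$, $\Gamma\vdash_\Sigma K$, $\Gamma\vdash_\Sigma \sigma:K$, $\Gamma\vdash_\Sigma M:\sigma$, derived by the rules: Signatures: $\emptyset\ \mathrm{sig}$; from $\vdash_\Sigma K$ and $a\notin\mathrm{Dom}(\Sigma)$ infer $\Sigma,a:K\ \mathrm{sig}$; from $\vdash_\Sigma\sigma:\mathrm{Type}$ and $c\notin\mathrm{Dom}(\Sigma)$ infer $\Sigma,c:\sigma\ \mathrm{sig}$. Contexts: from $\Sigma\ \mathrm{sig}$ infer $\vdash_\Sigma\emptyset$; from $\Gamma\vdash_\Sigma\sigma:\mathrm{Type}$ and $x\notin\mathrm{Dom}(\Gamma)$ infer $\vdash_\Sigma\Gamma,x:\sigma$. Kinds: from $\vdash_\Sigma\Gamma$ infer $\Gamma\vdash_\Sigma\mathrm{Type}$; from $\Gamma,x:\sigma\vdash_\Sigma K$ infer $\Gamma\vdash_\Sigma\Pi x{:}\sigma.K$. Families: from $\vdash_\Sigma\Gamma$, $a:K\in\Sigma$ infer $\Gamma\vdash_\Sigma a:K$; from $\Gamma,x:\sigma\vdash_\Sigma\tau:\mathrm{Type}$ infer $\Gamma\vdash_\Sigma\Pi x{:}\sigma.\tau:\mathrm{Type}$; from $\Gamma\vdash_\Sigma\sigma:\Pi x{:}\tau.K$ and $\Gamma\vdash_\Sigma N:\tau$ infer $\Gamma\vdash_\Sigma\sigma N:K[N/x]$; from $\Gamma\vdash_\Sigma\rho:\mathrm{Type}$ and $\Gamma\vdash_\Sigma N:\sigma$ infer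 $\Gamma\vdash_\Sigma\mathcal{L}^{\mathcal{P}}_{N,\sigma}[\rho]:\mathrm{Type}$; from $\Gamma\vdash_\Sigma\sigma:K$, $\Gamma\vdash_\Sigma K'$, $K=_{\beta\mathcal{L}}K'$ infer $\Gamma\vdash_\Sigma\sigma:K'$; (F-Guarded-Unlock) from $\Gamma,x:\tau\vdash_\Sigma\mathcal{L}^{\mathcal{P}}_{S,\sigma}[\rho]:\mathrm{Type}$, $\Gamma\vdash_\Sigma N:\mathcal{L}^{\mathcal{P}}_{S',\sigma'}[\tau]$, $\sigma=_{\beta\mathcal{L}}\sigma'$, $S=_{\beta\mathcal{L}}S'$ infer $\Gamma\vdash_\Sigma\mathcal{L}^{\mathcal{P}}_{S,\sigma}[\rho[\mathcal{U}^{\mathcal{P}}_{S',\sigma'}[N]/x]]:\mathrm{Type}$. Objects: from $\vdash_\Sigma\Gamma$, $c:\sigma\in\Sigma$ infer $\Gamma\vdash_\Sigma c:\sigma$; from $\vdash_\Sigma\Gamma$, $x:\sigma\in\Gamma$ infer $\Gamma\vdash_\Sigma x:\sigma$; from $\Gamma,x:\sigma\vdash_\Sigma M:\tau$ infer $\Gamma\vdash_\Sigma\lambda x{:}\sigma.M:\Pi x{:}\sigma.\tau$; from $\Gamma\vdash_\Sigma M:\Pi x{:}\sigma.\tau$ and $\Gamma\vdash_\Sigma N:\sigma$ infer $\Gamma\vdash_\Sigma MN:\tau[N/x]$; from $\Gamma\vdash_\Sigma M:\sigma$, $\Gamma\vdash_\Sigma\tau:\mathrm{Type}$, $\sigma=_{\beta\mathcal{L}}\tau$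 infer $\Gamma\vdash_\Sigma M:\tau$; (O-Lock) from $\Gamma\vdash_\Sigma M:\rho$ and $\Gamma\vdash_\Sigma N:\sigma$ infer $\Gamma\vdash_\Sigma\mathcal{L}^{\mathcal{P}}_{N,\sigma}[M]:\mathcal{L}^{\mathcal{P}}_{N,\sigma}[\rho]$; (O-Top-Unlock) from $\Gamma\vdash_\Sigma M:\mathcal{L}^{\mathcal{P}}_{N,\sigma}[\rho]$ and the (externally decided) fact that $\mathcal{P}(\Gamma\vdash_\Sigma N:\sigma)$ holds, infer $\Gamma\vdash_\Sigma\mathcal{U}^{\mathcal{P}}_{N,\sigma}[M]:\rho$; (O-Guarded-Unlock) from $\Gamma,x:\tau\vdash_\Sigma\mathcal{L}^{\mathcal{P}}_{S,\sigma}[M]:\mathcal{L}^{\mathcal{P}}_{S,\sigma}[\rho]$, $\Gamma\vdash_\Sigma N:\mathcal{L}^{\mathcal{P}}_{S',\sigma'}[\tau]$, $\sigma=_{\beta\mathcal{L}}\sigma'$, $S=_{\beta\mathcal{L}}S'$ infer $\Gamma\vdash_\Sigma\mathcal{L}^{\mathcal{P}}_{S,\sigma}[M[\mathcal{U}^{\mathcal{P}}_{S',\sigma'}[N]/x]]:\mathcal{L}^{\mathcal{P}}_{S,\sigma}[\rho[\mathcal{U}^{\mathcal{P}}_{S',\sigma'}[N]/x]]$. -}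

module Defs where

-- Variables are de Bruijn indices (index 0 = most recently bound);
-- constants (family constants a and object constants c) are names in ℕ.
-- Lock/unlock operators carry a predicate label drawn from the
-- parameter set Pred (the set 𝒫 of predicates); its meaning on typing
-- judgements is given separately (module Typing, parameter Holds).

open import Data.Nat using (ℕ; zero; suc)
open import Data.List using (List; []; _∷_; map)
open import Data.List.Membership.Propositional using (_∈_; _∉_)
open import Induction.WellFounded using (Acc)
open import Relation.Binary.Construct.Closure.Equivalence using (EqClosure)

Name : Set
Name = ℕ

module LLFP (Pred : Set) where

  mutual
    data Kind : Set where
      type : Kind
      Πk   : Fam → Kind → Kind                 -- Π x:σ. K   (binds index 0 in K)

    data Fam : Set where
      fcst  : Name → Fam
      Π     : Fam → Fam → Fam                  -- Π x:σ. τ  (binds index 0 in τ)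
      fapp  : Fam → Obj → Fam
      lockF : Pred → Obj → Fam → Fam → Fam     -- L^P_{N,σ}[ρ]  as  lockF P N σ ρ

    data Obj : Set where
      ocst   : Name → Obj
      var    : ℕ → Obj
      lam    : Fam → Obj → Obj                 -- λ x:σ. M  (binds index 0 in M)
      oapp   : Obj → Obj → Obj
      lock   : Pred → Obj → Fam → Obj → Obj    -- L^P_{N,σ}[M] as lock P N σ M
      unlock : Pred → Obj → Fam → Obj → Obj    -- U^P_{N,σ}[M] as unlock P N σ M

  ext : (ℕ → ℕ) → ℕ → ℕ
  ext ρ zero    = zero
  ext ρ (suc i) = suc (ρ i)

  mutual
    renK : (ℕ → ℕ) → Kind → Kind
    renK ρ type      = type
    renK ρ (Πk σ K)  = Πk (renF ρ σ) (renK (ext ρ) K)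

    renF : (ℕ → ℕ) → Fam → Fam
    renF ρ (fcst a)        = fcst a
    renF ρ (Π σ τ)         = Π (renF ρ σ) (renF (ext ρ) τ)
    renF ρ (fapp σ N)      = fapp (renF ρ σ) (renO ρ N)
    renF ρ (lockF P N σ τ) = lockF P (renO ρ N) (renF ρ σ) (renF ρ τ)

    renO : (ℕ → ℕ) → Obj → Obj
    renO ρ (ocst c)         = ocst c
    renO ρ (var i)          = var (ρ i)
    renO ρ (lam σ M)        = lam (renF ρ σ) (renO (ext ρ) M)
    renO ρ (oapp M N)       = oapp (renO ρ M) (renO ρ N)
    renO ρ (lock P N σ M)   = lock P (renO ρ N) (renF ρ σ) (renO ρ M)
    renO ρ (unlock P N σ M) = unlock P (renO ρ N) (renF ρ σ) (renO ρ M)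

  Subst : Set
  Subst = ℕ → Obj

  exts : Subst → Subst
  exts s zero    = var zero
  exts s (suc i) = renO suc (s i)

  mutual
    subK : Subst → Kind → Kind
    subK s type     = type
    subK s (Πk σ K) = Πk (subF s σ) (subK (exts s) K)

    subF : Subst → Fam → Fam
    subF s (fcst a)        = fcst a
    subF s (Π σ τ)         = Π (subF s σ) (subF (exts s) τ)
    subF s (fapp σ N)      = fapp (subF s σ) (subO s N)
    subF s (lockF P N σ τ) = lockF P (subO s N) (subF s σ) (subF s τ)

    subO : Subst → Obj → Obj
    subO s (ocst c)         = ocst c
    subO s (var i)          = s i
    subO s (lam σ M)        = lam (subF s σ) (subO (exts s) M)
    subO s (oapp M N)       = oapp (subO s M) (subO s N)
    subO s (lock P N σ M)   = lock P (subO s N) (subF s σ) (subO s M)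
    subO s (unlock P N σ M) = unlock P (subO s N) (subF s σ) (subO s M)

  single : Obj → Subst
  single N zero    = N
  single N (suc i) = var i

  _[_]K : Kind → Obj → Kind
  K [ N ]K = subK (single N) K

  _[_]F : Fam → Obj → Fam
  σ [ N ]F = subF (single N) σ

  _[_]O : Obj → Obj → Obj
  M [ N ]O = subO (single N) M

  wkF : Fam → Fam
  wkF = renF suc

  wkO : Obj → Obj
  wkO = renO suc

  mutual
    data _⟶K_ : Kind → Kind → Set where
      Πk₁ : ∀ {σ σ' K} → σ ⟶F σ' → Πk σ K ⟶K Πk σ' K
      Πk₂ : ∀ {σ K K'} → K ⟶K K' → Πk σ K ⟶K Πk σ K'

    data _⟶F_ : Fam → Fam → Set where
      Π₁     : ∀ {σ σ' τ} → σ ⟶F σ' → Π σ τ ⟶F Π σ' τ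
      Π₂     : ∀ {σ τ τ'} → τ ⟶F τ' → Π σ τ ⟶F Π σ τ'
      fapp₁  : ∀ {σ σ' N} → σ ⟶F σ' → fapp σ N ⟶F fapp σ' N
      fapp₂  : ∀ {σ N N'} → N ⟶O N' → fapp σ N ⟶F fapp σ N'
      lockF₁ : ∀ {P N N' σ ρ} → N ⟶O N' → lockF P N σ ρ ⟶F lockF P N' σ ρ
      lockF₂ : ∀ {P N σ σ' ρ} → σ ⟶F σ' → lockF P N σ ρ ⟶F lockF P N σ' ρ
      lockF₃ : ∀ {P N σ ρ ρ'} → ρ ⟶F ρ' → lockF P N σ ρ ⟶F lockF P N σ ρ'

    data _⟶O_ : Obj → Obj → Set where
      β        : ∀ {σ M N} → oapp (lam σ M) N ⟶O (M [ N ]O)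
      βL       : ∀ {P N σ M} → unlock P N σ (lock P N σ M) ⟶O M
      lam₁     : ∀ {σ σ' M} → σ ⟶F σ' → lam σ M ⟶O lam σ' M
      lam₂     : ∀ {σ M M'} → M ⟶O M' → lam σ M ⟶O lam σ M'
      oapp₁    : ∀ {M M' N} → M ⟶O M' → oapp M N ⟶O oapp M' N
      oapp₂    : ∀ {M N N'} → N ⟶O N' → oapp M N ⟶O oapp M N'
      lock₁    : ∀ {P N N' σ M} → N ⟶O N' → lock P N σ M ⟶O lock P N' σ M
      lock₂    : ∀ {P N σ σ' M} → σ ⟶F σ' → lock P N σ M ⟶O lock P N σ' M
      lock₃    : ∀ {P N σ M M'} → M ⟶O M' → lock P N σ M ⟶O lock P N σ M'
      unlock₁  : ∀ {P N N' σ M} → N ⟶O N' → unlock P N σ M ⟶O unlock P N' σ M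
      unlock₂  : ∀ {P N σ σ' M} → σ ⟶F σ' → unlock P N σ M ⟶O unlock P N σ' M
      unlock₃  : ∀ {P N σ M M'} → M ⟶O M' → unlock P N σ M ⟶O unlock P N σ M'

  _=K_ : Kind → Kind → Set
  _=K_ = EqClosure _⟶K_

  _=F_ : Fam → Fam → Set
  _=F_ = EqClosure _⟶F_

  _=O_ : Obj → Obj → Set
  _=O_ = EqClosure _⟶O_

  SN : {A : Set} → (A → A → Set) → A → Set
  SN _⟶_ = Acc (λ y x → x ⟶ y)

  SNK : Kind → Set
  SNK = SN _⟶K_

  SNF : Fam → Set
  SNF = SN _⟶F_

  SNO : Obj → Set
  SNO = SN _⟶O_

  data Decl : Set where
    famD : Name → Kind → Decl
    objD : Name → Fam → Decl

  declName : Decl → Name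
  declName (famD a _) = a
  declName (objD c _) = c

  -- most recent declaration first
  Sig : Set
  Sig = List Decl

  Dom : Sig → List Name
  Dom = map declName

  -- context: most recent variable (index 0) first
  Ctx : Set
  Ctx = List Fam

  -- Γ ∋ x ∶ σ : variable x has type σ in Γ (weakened to the whole of Γ)
  data _∋_∶_ : Ctx → ℕ → Fam → Set where
    here  : ∀ {Γ σ} → (σ ∷ Γ) ∋ zero ∶ wkF σ
    there : ∀ {Γ σ τ i} → Γ ∋ i ∶ σ → (τ ∷ Γ) ∋ suc i ∶ wkF σ

  -- the type of the external predicates: P(Γ ⊢_Σ N : σ)
  PredInterp : Set₁
  PredInterp = Pred → Sig → Ctx → Obj → Fam → Set

  module Typing (Holds : PredInterp) where

    mutual
      data _sig : Sig → Set where
        S-empty : [] sig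
        S-fam   : ∀ {Σs K a} → [] ⊢[ Σs ] K kind → a ∉ Dom Σs → (famD a K ∷ Σs) sig
        S-obj   : ∀ {Σs σ c} → [] ⊢[ Σs ] σ ∶ type → c ∉ Dom Σs → (objD c σ ∷ Σs) sig

      data ⊢[_]_ : Sig → Ctx → Set where
        C-empty : ∀ {Σs} → Σs sig → ⊢[ Σs ] []
        C-ext   : ∀ {Σs Γ σ} → Γ ⊢[ Σs ] σ ∶ type → ⊢[ Σs ] (σ ∷ Γ)

      data _⊢[_]_kind : Ctx → Sig → Kind → Set where
        K-type : ∀ {Σs Γ} → ⊢[ Σs ] Γ → Γ ⊢[ Σs ] type kind
        K-Π    : ∀ {Σs Γ σ K} → (σ ∷ Γ) ⊢[ Σs ] K kind → Γ ⊢[ Σs ] Πk σ K kind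

      data _⊢[_]_∶_ : Ctx → Sig → Fam → Kind → Set where
        F-const : ∀ {Σs Γ a K} → ⊢[ Σs ] Γ → famD a K ∈ Σs → Γ ⊢[ Σs ] fcst a ∶ K
        F-Π     : ∀ {Σs Γ σ τ} → (σ ∷ Γ) ⊢[ Σs ] τ ∶ type → Γ ⊢[ Σs ] Π σ τ ∶ type
        F-app   : ∀ {Σs Γ σ τ K N} → Γ ⊢[ Σs ] σ ∶ Πk τ K → Γ ⊢[ Σs ] N ⦂ τ →
                  Γ ⊢[ Σs ] fapp σ N ∶ (K [ N ]K)
        F-lock  : ∀ {Σs Γ P N σ ρ} → Γ ⊢[ Σs ] ρ ∶ type → Γ ⊢[ Σs ] N ⦂ σ →
                  Γ ⊢[ Σs ] lockF P N σ ρ ∶ type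
        F-conv  : ∀ {Σs Γ σ K K'} → Γ ⊢[ Σs ] σ ∶ K → Γ ⊢[ Σs ] K' kind → K =K K' →
                  Γ ⊢[ Σs ] σ ∶ K'
        -- S and σ live in Γ (x is not free in them): weakened in the premise
        F-guarded-unlock : ∀ {Σs Γ P S S' σ σ' ρ τ N} →
                  (τ ∷ Γ) ⊢[ Σs ] lockF P (wkO S) (wkF σ) ρ ∶ type →
                  Γ ⊢[ Σs ] N ⦂ lockF P S' σ' τ → σ =F σ' → S =O S' →
                  Γ ⊢[ Σs ] lockF P S σ (ρ [ unlock P S' σ' N ]F) ∶ type

      data _⊢[_]_⦂_ : Ctx → Sig → Obj → Fam → Set where
        O-const : ∀ {Σs Γ c σ} → ⊢[ Σs ] Γ → objD c σ ∈ Σs → Γ ⊢[ Σs ] ocst c ⦂ σ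
        O-var   : ∀ {Σs Γ x σ} → ⊢[ Σs ] Γ → Γ ∋ x ∶ σ → Γ ⊢[ Σs ] var x ⦂ σ
        O-abs   : ∀ {Σs Γ σ τ M} → (σ ∷ Γ) ⊢[ Σs ] M ⦂ τ → Γ ⊢[ Σs ] lam σ M ⦂ Π σ τ
        O-app   : ∀ {Σs Γ σ τ M N} → Γ ⊢[ Σs ] M ⦂ Π σ τ → Γ ⊢[ Σs ] N ⦂ σ →
                  Γ ⊢[ Σs ] oapp M N ⦂ (τ [ N ]F)
        O-conv  : ∀ {Σs Γ M σ τ} → Γ ⊢[ Σs ] M ⦂ σ → Γ ⊢[ Σs ] τ ∶ type → σ =F τ →
                  Γ ⊢[ Σs ] M ⦂ τ
        O-lock  : ∀ {Σs Γ P M ρ N σ} → Γ ⊢[ Σs ] M ⦂ ρ → Γ ⊢[ Σs ] N ⦂ σ →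
                  Γ ⊢[ Σs ] lock P N σ M ⦂ lockF P N σ ρ
        O-top-unlock : ∀ {Σs Γ P M N σ ρ} → Γ ⊢[ Σs ] M ⦂ lockF P N σ ρ →
                  Holds P Σs Γ N σ →
                  Γ ⊢[ Σs ] unlock P N σ M ⦂ ρ
        O-guarded-unlock : ∀ {Σs Γ P S S' σ σ' ρ τ M N} →
                  (τ ∷ Γ) ⊢[ Σs ] lock P (wkO S) (wkF σ) M ⦂ lockF P (wkO S) (wkF σ) ρ →
                  Γ ⊢[ Σs ] N ⦂ lockF P S' σ' τ → σ =F σ' → S =O S' →
                  Γ ⊢[ Σs ] lock P S σ (M [ unlock P S' σ' N ]O)
                            ⦂ lockF P S σ (ρ [ unlock P S' σ' N ]F)

module Submission where

-- The proof erases dependent types to simple types.  The skeleton sk σ of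
-- a family is a simple type over one base type, built from _⇒_ (for Π) and
-- a unary modality L (for lock types); dependencies, lock annotations and
-- predicates are forgotten.  Skeletons are invariant under substitution and
-- βL-conversion, so every LLF_P derivation erases to a derivation in a
-- simple typing discipline for raw terms (_⊢ₛ_⦂_, _⊢ₛ_fam, _⊢ₛ_kind) in
-- which every annotation is itself simply typable.  For that discipline we
-- run Tait's reducibility argument: Red A M is strong normalisation at the
-- base type, the usual function space at A ⇒ B, and "M is SN and every
-- unlock of M is reducible at A" at L A.  The fundamental lemma makes every
-- simply typable term reducible under reducible substitutions; at the
-- identity substitution this yields the theorem.

open import Defs
open import Data.Product using (_×_; _,_; proj₁; proj₂)
open import Data.Nat using (ℕ; zero; suc)
open import Data.List using (List; []; _∷_; map)
open import Data.List.Relation.Unary.Any using (here; there)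
open import Data.List.Membership.Propositional using (_∈_)
open import Data.Unit using (⊤; tt)
open import Data.Empty using (⊥)
open import Function using (_∘_)
open import Relation.Binary.PropositionalEquality
  using (_≡_; refl; sym; trans; cong; cong₂; subst; module ≡-Reasoning)
open import Induction.WellFounded using (Acc; acc; module Subrelation)
open import Relation.Binary.Construct.On as On using ()
open import Relation.Binary.Construct.Closure.ReflexiveTransitive using (ε; _◅_)
open import Relation.Binary.Construct.Closure.Symmetric using (fwd; bwd)

cong₃ : ∀ {A B C D : Set} (f : A → B → C → D) {a a' b b' c c'} →
        a ≡ a' → b ≡ b' → c ≡ c' → f a b c ≡ f a' b' c'
cong₃ f refl refl refl = refl

module Normalisation (Pred : Set) where
  open LLFP Pred

  SN-pullback : {A B : Set} {_⟶_ : A → A → Set} {_⟶'_ : B → B → Set} (f : A → B) →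
                (∀ {x y} → x ⟶ y → f x ⟶' f y) → ∀ {x} → SN _⟶'_ (f x) → SN _⟶_ x
  SN-pullback f step = Subrelation.accessible step ∘ On.accessible f

  ext-cong : ∀ {ρ ρ' : ℕ → ℕ} → (∀ i → ρ i ≡ ρ' i) → ∀ i → ext ρ i ≡ ext ρ' i
  ext-cong e zero    = refl
  ext-cong e (suc i) = cong suc (e i)

  mutual
    renF-cong : ∀ {ρ ρ'} → (∀ i → ρ i ≡ ρ' i) → ∀ σ → renF ρ σ ≡ renF ρ' σ
    renF-cong e (fcst a)        = refl
    renF-cong e (Π σ τ)         = cong₂ Π (renF-cong e σ) (renF-cong (ext-cong e) τ)
    renF-cong e (fapp σ N)      = cong₂ fapp (renF-cong e σ) (renO-cong e N)
    renF-cong e (lockF P N σ τ) = cong₃ (lockF P) (renO-cong e N) (renF-cong e σ) (renF-cong e τ)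

    renO-cong : ∀ {ρ ρ'} → (∀ i → ρ i ≡ ρ' i) → ∀ M → renO ρ M ≡ renO ρ' M
    renO-cong e (ocst c)         = refl
    renO-cong e (var i)          = cong var (e i)
    renO-cong e (lam σ M)        = cong₂ lam (renF-cong e σ) (renO-cong (ext-cong e) M)
    renO-cong e (oapp M N)       = cong₂ oapp (renO-cong e M) (renO-cong e N)
    renO-cong e (lock P N σ M)   = cong₃ (lock P) (renO-cong e N) (renF-cong e σ) (renO-cong e M)
    renO-cong e (unlock P N σ M) = cong₃ (unlock P) (renO-cong e N) (renF-cong e σ) (renO-cong e M)

  exts-cong : ∀ {s s' : Subst} → (∀ i → s i ≡ s' i) → ∀ i → exts s i ≡ exts s' i
  exts-cong e zero    = refl
  exts-cong e (suc i) = cong (renO suc) (e i)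

  mutual
    subK-cong : ∀ {s s'} → (∀ i → s i ≡ s' i) → ∀ K → subK s K ≡ subK s' K
    subK-cong e type     = refl
    subK-cong e (Πk σ K) = cong₂ Πk (subF-cong e σ) (subK-cong (exts-cong e) K)

    subF-cong : ∀ {s s'} → (∀ i → s i ≡ s' i) → ∀ σ → subF s σ ≡ subF s' σ
    subF-cong e (fcst a)        = refl
    subF-cong e (Π σ τ)         = cong₂ Π (subF-cong e σ) (subF-cong (exts-cong e) τ)
    subF-cong e (fapp σ N)      = cong₂ fapp (subF-cong e σ) (subO-cong e N)
    subF-cong e (lockF P N σ τ) = cong₃ (lockF P) (subO-cong e N) (subF-cong e σ) (subF-cong e τ)

    subO-cong : ∀ {s s'} → (∀ i → s i ≡ s' i) → ∀ M → subO s M ≡ subO s' M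
    subO-cong e (ocst c)         = refl
    subO-cong e (var i)          = e i
    subO-cong e (lam σ M)        = cong₂ lam (subF-cong e σ) (subO-cong (exts-cong e) M)
    subO-cong e (oapp M N)       = cong₂ oapp (subO-cong e M) (subO-cong e N)
    subO-cong e (lock P N σ M)   = cong₃ (lock P) (subO-cong e N) (subF-cong e σ) (subO-cong e M)
    subO-cong e (unlock P N σ M) = cong₃ (unlock P) (subO-cong e N) (subF-cong e σ) (subO-cong e M)

  ext-∘ : ∀ (ρ ρ' : ℕ → ℕ) i → ext ρ (ext ρ' i) ≡ ext (ρ ∘ ρ') i
  ext-∘ ρ ρ' zero    = refl
  ext-∘ ρ ρ' (suc i) = refl

  mutual
    ren-renF : ∀ ρ ρ' σ → renF ρ (renF ρ' σ) ≡ renF (ρ ∘ ρ') σ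
    ren-renF ρ ρ' (fcst a)        = refl
    ren-renF ρ ρ' (Π σ τ)         =
      cong₂ Π (ren-renF ρ ρ' σ) (trans (ren-renF (ext ρ) (ext ρ') τ) (renF-cong (ext-∘ ρ ρ') τ))
    ren-renF ρ ρ' (fapp σ N)      = cong₂ fapp (ren-renF ρ ρ' σ) (ren-renO ρ ρ' N)
    ren-renF ρ ρ' (lockF P N σ τ) = cong₃ (lockF P) (ren-renO ρ ρ' N) (ren-renF ρ ρ' σ) (ren-renF ρ ρ' τ)

    ren-renO : ∀ ρ ρ' M → renO ρ (renO ρ' M) ≡ renO (ρ ∘ ρ') M
    ren-renO ρ ρ' (ocst c)         = refl
    ren-renO ρ ρ' (var i)          = refl
    ren-renO ρ ρ' (lam σ M)        =
      cong₂ lam (ren-renF ρ ρ' σ) (trans (ren-renO (ext ρ) (ext ρ') M) (renO-cong (ext-∘ ρ ρ') M))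
    ren-renO ρ ρ' (oapp M N)       = cong₂ oapp (ren-renO ρ ρ' M) (ren-renO ρ ρ' N)
    ren-renO ρ ρ' (lock P N σ M)   = cong₃ (lock P) (ren-renO ρ ρ' N) (ren-renF ρ ρ' σ) (ren-renO ρ ρ' M)
    ren-renO ρ ρ' (unlock P N σ M) = cong₃ (unlock P) (ren-renO ρ ρ' N) (ren-renF ρ ρ' σ) (ren-renO ρ ρ' M)

  exts-ext : ∀ (s : Subst) ρ i → exts s (ext ρ i) ≡ exts (s ∘ ρ) i
  exts-ext s ρ zero    = refl
  exts-ext s ρ (suc i) = refl

  mutual
    sub-renF : ∀ s ρ σ → subF s (renF ρ σ) ≡ subF (s ∘ ρ) σ
    sub-renF s ρ (fcst a)        = refl
    sub-renF s ρ (Π σ τ)         =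
      cong₂ Π (sub-renF s ρ σ) (trans (sub-renF (exts s) (ext ρ) τ) (subF-cong (exts-ext s ρ) τ))
    sub-renF s ρ (fapp σ N)      = cong₂ fapp (sub-renF s ρ σ) (sub-renO s ρ N)
    sub-renF s ρ (lockF P N σ τ) = cong₃ (lockF P) (sub-renO s ρ N) (sub-renF s ρ σ) (sub-renF s ρ τ)

    sub-renO : ∀ s ρ M → subO s (renO ρ M) ≡ subO (s ∘ ρ) M
    sub-renO s ρ (ocst c)         = refl
    sub-renO s ρ (var i)          = refl
    sub-renO s ρ (lam σ M)        =
      cong₂ lam (sub-renF s ρ σ) (trans (sub-renO (exts s) (ext ρ) M) (subO-cong (exts-ext s ρ) M))
    sub-renO s ρ (oapp M N)       = cong₂ oapp (sub-renO s ρ M) (sub-renO s ρ N)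
    sub-renO s ρ (lock P N σ M)   = cong₃ (lock P) (sub-renO s ρ N) (sub-renF s ρ σ) (sub-renO s ρ M)
    sub-renO s ρ (unlock P N σ M) = cong₃ (unlock P) (sub-renO s ρ N) (sub-renF s ρ σ) (sub-renO s ρ M)

  ren-exts : ∀ ρ (s : Subst) i → renO (ext ρ) (exts s i) ≡ exts (renO ρ ∘ s) i
  ren-exts ρ s zero    = refl
  ren-exts ρ s (suc i) = trans (ren-renO (ext ρ) suc (s i)) (sym (ren-renO suc ρ (s i)))

  mutual
    ren-subF : ∀ ρ s σ → renF ρ (subF s σ) ≡ subF (renO ρ ∘ s) σ
    ren-subF ρ s (fcst a)        = refl
    ren-subF ρ s (Π σ τ)         =
      cong₂ Π (ren-subF ρ s σ) (trans (ren-subF (ext ρ) (exts s) τ) (subF-cong (ren-exts ρ s) τ))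
    ren-subF ρ s (fapp σ N)      = cong₂ fapp (ren-subF ρ s σ) (ren-subO ρ s N)
    ren-subF ρ s (lockF P N σ τ) = cong₃ (lockF P) (ren-subO ρ s N) (ren-subF ρ s σ) (ren-subF ρ s τ)

    ren-subO : ∀ ρ s M → renO ρ (subO s M) ≡ subO (renO ρ ∘ s) M
    ren-subO ρ s (ocst c)         = refl
    ren-subO ρ s (var i)          = refl
    ren-subO ρ s (lam σ M)        =
      cong₂ lam (ren-subF ρ s σ) (trans (ren-subO (ext ρ) (exts s) M) (subO-cong (ren-exts ρ s) M))
    ren-subO ρ s (oapp M N)       = cong₂ oapp (ren-subO ρ s M) (ren-subO ρ s N)
    ren-subO ρ s (lock P N σ M)   = cong₃ (lock P) (ren-subO ρ s N) (ren-subF ρ s σ) (ren-subO ρ s M)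
    ren-subO ρ s (unlock P N σ M) = cong₃ (unlock P) (ren-subO ρ s N) (ren-subF ρ s σ) (ren-subO ρ s M)

  sub-exts : ∀ (s t : Subst) i → subO (exts s) (exts t i) ≡ exts (subO s ∘ t) i
  sub-exts s t zero    = refl
  sub-exts s t (suc i) = trans (sub-renO (exts s) suc (t i)) (sym (ren-subO suc s (t i)))

  mutual
    sub-subK : ∀ s t K → subK s (subK t K) ≡ subK (subO s ∘ t) K
    sub-subK s t type     = refl
    sub-subK s t (Πk σ K) =
      cong₂ Πk (sub-subF s t σ) (trans (sub-subK (exts s) (exts t) K) (subK-cong (sub-exts s t) K))

    sub-subF : ∀ s t σ → subF s (subF t σ) ≡ subF (subO s ∘ t) σ
    sub-subF s t (fcst a)        = refl
    sub-subF s t (Π σ τ)         =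
      cong₂ Π (sub-subF s t σ) (trans (sub-subF (exts s) (exts t) τ) (subF-cong (sub-exts s t) τ))
    sub-subF s t (fapp σ N)      = cong₂ fapp (sub-subF s t σ) (sub-subO s t N)
    sub-subF s t (lockF P N σ τ) = cong₃ (lockF P) (sub-subO s t N) (sub-subF s t σ) (sub-subF s t τ)

    sub-subO : ∀ s t M → subO s (subO t M) ≡ subO (subO s ∘ t) M
    sub-subO s t (ocst c)         = refl
    sub-subO s t (var i)          = refl
    sub-subO s t (lam σ M)        =
      cong₂ lam (sub-subF s t σ) (trans (sub-subO (exts s) (exts t) M) (subO-cong (sub-exts s t) M))
    sub-subO s t (oapp M N)       = cong₂ oapp (sub-subO s t M) (sub-subO s t N)
    sub-subO s t (lock P N σ M)   = cong₃ (lock P) (sub-subO s t N) (sub-subF s t σ) (sub-subO s t M)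
    sub-subO s t (unlock P N σ M) = cong₃ (unlock P) (sub-subO s t N) (sub-subF s t σ) (sub-subO s t M)

  exts-var : ∀ i → exts var i ≡ var i
  exts-var zero    = refl
  exts-var (suc i) = refl

  mutual
    sub-idK : ∀ K → subK var K ≡ K
    sub-idK type     = refl
    sub-idK (Πk σ K) = cong₂ Πk (sub-idF σ) (trans (subK-cong exts-var K) (sub-idK K))

    sub-idF : ∀ σ → subF var σ ≡ σ
    sub-idF (fcst a)        = refl
    sub-idF (Π σ τ)         = cong₂ Π (sub-idF σ) (trans (subF-cong exts-var τ) (sub-idF τ))
    sub-idF (fapp σ N)      = cong₂ fapp (sub-idF σ) (sub-idO N)
    sub-idF (lockF P N σ τ) = cong₃ (lockF P) (sub-idO N) (sub-idF σ) (sub-idF τ)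

    sub-idO : ∀ M → subO var M ≡ M
    sub-idO (ocst c)         = refl
    sub-idO (var i)          = refl
    sub-idO (lam σ M)        = cong₂ lam (sub-idF σ) (trans (subO-cong exts-var M) (sub-idO M))
    sub-idO (oapp M N)       = cong₂ oapp (sub-idO M) (sub-idO N)
    sub-idO (lock P N σ M)   = cong₃ (lock P) (sub-idO N) (sub-idF σ) (sub-idO M)
    sub-idO (unlock P N σ M) = cong₃ (unlock P) (sub-idO N) (sub-idF σ) (sub-idO M)

  single-wkF : ∀ N σ → wkF σ [ N ]F ≡ σ
  single-wkF N σ = trans (sub-renF (single N) suc σ) (sub-idF σ)

  single-wkO : ∀ N M → wkO M [ N ]O ≡ M
  single-wkO N M = trans (sub-renO (single N) suc M) (sub-idO M)

  _•_ : Obj → Subst → Subst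
  (N • s) zero    = N
  (N • s) (suc i) = s i

  single-exts : ∀ N s i → exts s i [ N ]O ≡ (N • s) i
  single-exts N s zero    = refl
  single-exts N s (suc i) = single-wkO N (s i)

  single-extsK : ∀ N s K → subK (exts s) K [ N ]K ≡ subK (N • s) K
  single-extsK N s K = trans (sub-subK (single N) (exts s) K) (subK-cong (single-exts N s) K)

  single-extsF : ∀ N s σ → subF (exts s) σ [ N ]F ≡ subF (N • s) σ
  single-extsF N s σ = trans (sub-subF (single N) (exts s) σ) (subF-cong (single-exts N s) σ)

  single-extsO : ∀ N s M → subO (exts s) M [ N ]O ≡ subO (N • s) M
  single-extsO N s M = trans (sub-subO (single N) (exts s) M) (subO-cong (single-exts N s) M)

  sub-single : ∀ s N M → subO s (M [ N ]O) ≡ subO (exts s) M [ subO s N ]O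
  sub-single s N M = begin
      subO s (M [ N ]O)                        ≡⟨ sub-subO s (single N) M ⟩
      subO (subO s ∘ single N) M               ≡⟨ subO-cong pointwise M ⟩
      subO (subO (single (subO s N)) ∘ exts s) M ≡⟨ sym (sub-subO (single (subO s N)) (exts s) M) ⟩
      subO (exts s) M [ subO s N ]O            ∎
    where
    open ≡-Reasoning
    pointwise : ∀ i → subO s (single N i) ≡ exts s i [ subO s N ]O
    pointwise zero    = refl
    pointwise (suc i) = sym (single-wkO (subO s N) (s i))

  mutual
    sub-⟶K : ∀ s {K K'} → K ⟶K K' → subK s K ⟶K subK s K'
    sub-⟶K s (Πk₁ r) = Πk₁ (sub-⟶F s r)
    sub-⟶K s (Πk₂ r) = Πk₂ (sub-⟶K (exts s) r)

    sub-⟶F : ∀ s {σ σ'} → σ ⟶F σ' → subF s σ ⟶F subF s σ'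
    sub-⟶F s (Π₁ r)     = Π₁ (sub-⟶F s r)
    sub-⟶F s (Π₂ r)     = Π₂ (sub-⟶F (exts s) r)
    sub-⟶F s (fapp₁ r)  = fapp₁ (sub-⟶F s r)
    sub-⟶F s (fapp₂ r)  = fapp₂ (sub-⟶O s r)
    sub-⟶F s (lockF₁ r) = lockF₁ (sub-⟶O s r)
    sub-⟶F s (lockF₂ r) = lockF₂ (sub-⟶F s r)
    sub-⟶F s (lockF₃ r) = lockF₃ (sub-⟶F s r)

    sub-⟶O : ∀ s {M M'} → M ⟶O M' → subO s M ⟶O subO s M'
    sub-⟶O s (β {σ} {M} {N}) = subst (oapp (lam (subF s σ) (subO (exts s) M)) (subO s N) ⟶O_)
                                      (sym (sub-single s N M)) β
    sub-⟶O s βL          = βL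
    sub-⟶O s (lam₁ r)    = lam₁ (sub-⟶F s r)
    sub-⟶O s (lam₂ r)    = lam₂ (sub-⟶O (exts s) r)
    sub-⟶O s (oapp₁ r)   = oapp₁ (sub-⟶O s r)
    sub-⟶O s (oapp₂ r)   = oapp₂ (sub-⟶O s r)
    sub-⟶O s (lock₁ r)   = lock₁ (sub-⟶O s r)
    sub-⟶O s (lock₂ r)   = lock₂ (sub-⟶F s r)
    sub-⟶O s (lock₃ r)   = lock₃ (sub-⟶O s r)
    sub-⟶O s (unlock₁ r) = unlock₁ (sub-⟶O s r)
    sub-⟶O s (unlock₂ r) = unlock₂ (sub-⟶F s r)
    sub-⟶O s (unlock₃ r) = unlock₃ (sub-⟶O s r)

  data Ty : Set where
    ι   : Ty
    _⇒_ : Ty → Ty → Ty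
    L   : Ty → Ty

  sk : Fam → Ty
  sk (fcst a)        = ι
  sk (Π σ τ)         = sk σ ⇒ sk τ
  sk (fapp σ N)      = sk σ
  sk (lockF P N σ ρ) = L (sk ρ)

  -- Skeletons ignore objects, hence renaming, substitution and conversion.
  sk-ren : ∀ ρ σ → sk (renF ρ σ) ≡ sk σ
  sk-ren ρ (fcst a)        = refl
  sk-ren ρ (Π σ τ)         = cong₂ _⇒_ (sk-ren ρ σ) (sk-ren (ext ρ) τ)
  sk-ren ρ (fapp σ N)      = sk-ren ρ σ
  sk-ren ρ (lockF P N σ τ) = cong L (sk-ren ρ τ)

  sk-sub : ∀ s σ → sk (subF s σ) ≡ sk σ
  sk-sub s (fcst a)        = refl
  sk-sub s (Π σ τ)         = cong₂ _⇒_ (sk-sub s σ) (sk-sub (exts s) τ)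
  sk-sub s (fapp σ N)      = sk-sub s σ
  sk-sub s (lockF P N σ τ) = cong L (sk-sub s τ)

  sk-⟶ : ∀ {σ σ'} → σ ⟶F σ' → sk σ ≡ sk σ'
  sk-⟶ (Π₁ r)     = cong (_⇒ _) (sk-⟶ r)
  sk-⟶ (Π₂ r)     = cong (_ ⇒_) (sk-⟶ r)
  sk-⟶ (fapp₁ r)  = sk-⟶ r
  sk-⟶ (fapp₂ r)  = refl
  sk-⟶ (lockF₁ r) = refl
  sk-⟶ (lockF₂ r) = refl
  sk-⟶ (lockF₃ r) = cong L (sk-⟶ r)

  sk-conv : ∀ {σ σ'} → σ =F σ' → sk σ ≡ sk σ'
  sk-conv ε            = refl
  sk-conv (fwd r ◅ rs) = trans (sk-⟶ r) (sk-conv rs)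
  sk-conv (bwd r ◅ rs) = trans (sym (sk-⟶ r)) (sk-conv rs)

  -- Contexts are lists of simple types; bound
  -- variables get the skeleton of their annotation; annotations of locks and
  -- unlocks only need to be simply typable at some type; constants may be
  -- used at any type (they are inert, hence reducible at every type).

  data _∋ₜ_⦂_ : List Ty → ℕ → Ty → Set where
    hd : ∀ {Δ A} → (A ∷ Δ) ∋ₜ zero ⦂ A
    tl : ∀ {Δ A B i} → Δ ∋ₜ i ⦂ A → (B ∷ Δ) ∋ₜ suc i ⦂ A

  mutual
    data _⊢ₛ_⦂_ : List Ty → Obj → Ty → Set where
      s-cst    : ∀ {Δ c A} → Δ ⊢ₛ ocst c ⦂ A
      s-var    : ∀ {Δ i A} → Δ ∋ₜ i ⦂ A → Δ ⊢ₛ var i ⦂ A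
      s-lam    : ∀ {Δ σ M A B} → Δ ⊢ₛ σ fam → sk σ ≡ A → (A ∷ Δ) ⊢ₛ M ⦂ B →
                 Δ ⊢ₛ lam σ M ⦂ (A ⇒ B)
      s-app    : ∀ {Δ M N A B} → Δ ⊢ₛ M ⦂ (A ⇒ B) → Δ ⊢ₛ N ⦂ A → Δ ⊢ₛ oapp M N ⦂ B
      s-lock   : ∀ {Δ P N σ M A C} → Δ ⊢ₛ N ⦂ C → Δ ⊢ₛ σ fam → Δ ⊢ₛ M ⦂ A →
                 Δ ⊢ₛ lock P N σ M ⦂ L A
      s-unlock : ∀ {Δ P N σ M A C} → Δ ⊢ₛ N ⦂ C → Δ ⊢ₛ σ fam → Δ ⊢ₛ M ⦂ L A →
                 Δ ⊢ₛ unlock P N σ M ⦂ A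

    data _⊢ₛ_fam : List Ty → Fam → Set where
      s-fcst  : ∀ {Δ a} → Δ ⊢ₛ fcst a fam
      s-Π     : ∀ {Δ σ τ A} → Δ ⊢ₛ σ fam → sk σ ≡ A → (A ∷ Δ) ⊢ₛ τ fam → Δ ⊢ₛ Π σ τ fam
      s-fapp  : ∀ {Δ σ N C} → Δ ⊢ₛ σ fam → Δ ⊢ₛ N ⦂ C → Δ ⊢ₛ fapp σ N fam
      s-lockF : ∀ {Δ P N σ ρ C} → Δ ⊢ₛ N ⦂ C → Δ ⊢ₛ σ fam → Δ ⊢ₛ ρ fam →
                Δ ⊢ₛ lockF P N σ ρ fam

  data _⊢ₛ_kind : List Ty → Kind → Set where
    s-type : ∀ {Δ} → Δ ⊢ₛ type kind
    s-Πk   : ∀ {Δ σ K A} → Δ ⊢ₛ σ fam → sk σ ≡ A → (A ∷ Δ) ⊢ₛ K kind → Δ ⊢ₛ Πk σ K kind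

  RenTyped : (ℕ → ℕ) → List Ty → List Ty → Set
  RenTyped ρ Δ Δ' = ∀ {i A} → Δ ∋ₜ i ⦂ A → Δ' ∋ₜ ρ i ⦂ A

  ext-typed : ∀ {ρ Δ Δ' A} → RenTyped ρ Δ Δ' → RenTyped (ext ρ) (A ∷ Δ) (A ∷ Δ')
  ext-typed r hd     = hd
  ext-typed r (tl x) = tl (r x)

  mutual
    ren-typedO : ∀ {ρ Δ Δ' M A} → RenTyped ρ Δ Δ' → Δ ⊢ₛ M ⦂ A → Δ' ⊢ₛ renO ρ M ⦂ A
    ren-typedO r s-cst           = s-cst
    ren-typedO r (s-var x)       = s-var (r x)
    ren-typedO {ρ} r (s-lam {σ = σ} f e m) =
      s-lam (ren-typedF r f) (trans (sk-ren ρ σ) e) (ren-typedO (ext-typed r) m)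
    ren-typedO r (s-app m n)     = s-app (ren-typedO r m) (ren-typedO r n)
    ren-typedO r (s-lock n f m)  = s-lock (ren-typedO r n) (ren-typedF r f) (ren-typedO r m)
    ren-typedO r (s-unlock n f m) = s-unlock (ren-typedO r n) (ren-typedF r f) (ren-typedO r m)

    ren-typedF : ∀ {ρ Δ Δ' σ} → RenTyped ρ Δ Δ' → Δ ⊢ₛ σ fam → Δ' ⊢ₛ renF ρ σ fam
    ren-typedF r s-fcst          = s-fcst
    ren-typedF {ρ} r (s-Π {σ = σ} f e t) =
      s-Π (ren-typedF r f) (trans (sk-ren ρ σ) e) (ren-typedF (ext-typed r) t)
    ren-typedF r (s-fapp f n)    = s-fapp (ren-typedF r f) (ren-typedO r n)
    ren-typedF r (s-lockF n f g) = s-lockF (ren-typedO r n) (ren-typedF r f) (ren-typedF r g)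

  SubTyped : Subst → List Ty → List Ty → Set
  SubTyped s Δ Δ' = ∀ {i A} → Δ ∋ₜ i ⦂ A → Δ' ⊢ₛ s i ⦂ A

  exts-typed : ∀ {s Δ Δ' A} → SubTyped s Δ Δ' → SubTyped (exts s) (A ∷ Δ) (A ∷ Δ')
  exts-typed r hd     = s-var hd
  exts-typed r (tl x) = ren-typedO tl (r x)

  single-typed : ∀ {Δ N A} → Δ ⊢ₛ N ⦂ A → SubTyped (single N) (A ∷ Δ) Δ
  single-typed n hd     = n
  single-typed n (tl x) = s-var x

  mutual
    sub-typedO : ∀ {s Δ Δ' M A} → SubTyped s Δ Δ' → Δ ⊢ₛ M ⦂ A → Δ' ⊢ₛ subO s M ⦂ A
    sub-typedO r s-cst            = s-cst
    sub-typedO r (s-var x)        = r x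
    sub-typedO {s} r (s-lam {σ = σ} f e m) =
      s-lam (sub-typedF r f) (trans (sk-sub s σ) e) (sub-typedO (exts-typed r) m)
    sub-typedO r (s-app m n)      = s-app (sub-typedO r m) (sub-typedO r n)
    sub-typedO r (s-lock n f m)   = s-lock (sub-typedO r n) (sub-typedF r f) (sub-typedO r m)
    sub-typedO r (s-unlock n f m) = s-unlock (sub-typedO r n) (sub-typedF r f) (sub-typedO r m)

    sub-typedF : ∀ {s Δ Δ' σ} → SubTyped s Δ Δ' → Δ ⊢ₛ σ fam → Δ' ⊢ₛ subF s σ fam
    sub-typedF r s-fcst          = s-fcst
    sub-typedF {s} r (s-Π {σ = σ} f e t) =
      s-Π (sub-typedF r f) (trans (sk-sub s σ) e) (sub-typedF (exts-typed r) t)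
    sub-typedF r (s-fapp f n)    = s-fapp (sub-typedF r f) (sub-typedO r n)
    sub-typedF r (s-lockF n f g) = s-lockF (sub-typedO r n) (sub-typedF r f) (sub-typedF r g)

  -- Consequences used by the erasure: instantiation, strengthening of
  -- weakened terms (instantiate with a constant), and weakening of closed
  -- families (apply the identity substitution).
  instantiateO : ∀ {Δ M N A B} → (A ∷ Δ) ⊢ₛ M ⦂ B → Δ ⊢ₛ N ⦂ A → Δ ⊢ₛ M [ N ]O ⦂ B
  instantiateO m n = sub-typedO (single-typed n) m

  instantiateF : ∀ {Δ σ N A} → (A ∷ Δ) ⊢ₛ σ fam → Δ ⊢ₛ N ⦂ A → Δ ⊢ₛ σ [ N ]F fam
  instantiateF f n = sub-typedF (single-typed n) f

  strengthenO : ∀ {Δ B A} M → (B ∷ Δ) ⊢ₛ wkO M ⦂ A → Δ ⊢ₛ M ⦂ A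
  strengthenO M m = subst (_ ⊢ₛ_⦂ _) (single-wkO (ocst 0) M) (instantiateO m s-cst)

  strengthenF : ∀ {Δ B} σ → (B ∷ Δ) ⊢ₛ wkF σ fam → Δ ⊢ₛ σ fam
  strengthenF σ f = subst (_ ⊢ₛ_fam) (single-wkF (ocst 0) σ) (instantiateF f s-cst)

  closedF : ∀ {Δ σ} → [] ⊢ₛ σ fam → Δ ⊢ₛ σ fam
  closedF {σ = σ} f = subst (_ ⊢ₛ_fam) (sub-idF σ) (sub-typedF (λ ()) f)

  -- Erasure of LLF_P derivations into simple typing.  The invariant carried
  -- along is that the context and the types of object constants erase to
  -- well-formed families.

  sk* : Ctx → List Ty
  sk* = map sk

  ValidCtx : Ctx → Set
  ValidCtx []      = ⊤
  ValidCtx (σ ∷ Γ) = sk* Γ ⊢ₛ σ fam × ValidCtx Γ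

  ValidSig : Sig → Set
  ValidSig Σs = ∀ {c σ} → objD c σ ∈ Σs → [] ⊢ₛ σ fam

  Valid : Sig → Ctx → Set
  Valid Σs Γ = ValidCtx Γ × ValidSig Σs

  erase-var : ∀ {Γ x σ} → ValidCtx Γ → Γ ∋ x ∶ σ → (sk* Γ ∋ₜ x ⦂ sk σ) × (sk* Γ ⊢ₛ σ fam)
  erase-var {σ ∷ Γ} (f , _) here =
    subst (sk* (σ ∷ Γ) ∋ₜ zero ⦂_) (sym (sk-ren suc σ)) hd , ren-typedF tl f
  erase-var {τ ∷ Γ} (_ , w) (there {σ = σ} {i = i} x) =
    let (l , g) = erase-var w x in
    subst (sk* (τ ∷ Γ) ∋ₜ suc i ⦂_) (sym (sk-ren suc σ)) (tl l) , ren-typedF tl g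

  Π-inv : ∀ {Δ σ τ} → Δ ⊢ₛ Π σ τ fam → (sk σ ∷ Δ) ⊢ₛ τ fam
  Π-inv (s-Π _ refl t) = t

  lockF-body : ∀ {Δ P N σ ρ} → Δ ⊢ₛ lockF P N σ ρ fam → Δ ⊢ₛ ρ fam
  lockF-body (s-lockF _ _ g) = g

  unlock-typed : ∀ {Δ P S σ τ N} → Δ ⊢ₛ N ⦂ L (sk τ) → Δ ⊢ₛ lockF P S σ τ fam →
                 Δ ⊢ₛ unlock P S σ N ⦂ sk τ
  unlock-typed n (s-lockF s f _) = s-unlock s f n

  -- The conclusions of the guarded-unlock rules: strengthen the lock
  -- annotations and instantiate the bound variable with the unlock U.
  guarded-fam : ∀ {Δ B P S σ ρ U} → (B ∷ Δ) ⊢ₛ lockF P (wkO S) (wkF σ) ρ fam →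
                Δ ⊢ₛ U ⦂ B → Δ ⊢ₛ lockF P S σ (ρ [ U ]F) fam
  guarded-fam {S = S} {σ} (s-lockF s f r) u =
    s-lockF (strengthenO S s) (strengthenF σ f) (instantiateF r u)

  guarded-obj : ∀ {Δ B P S σ ρ M U} → (B ∷ Δ) ⊢ₛ lock P (wkO S) (wkF σ) M ⦂ L (sk ρ) →
                Δ ⊢ₛ U ⦂ B → Δ ⊢ₛ lock P S σ (M [ U ]O) ⦂ L (sk (ρ [ U ]F))
  guarded-obj {S = S} {σ} {ρ} {U = U} (s-lock s f m) u =
    subst (λ A → _ ⊢ₛ _ ⦂ L A) (sym (sk-sub (single U) ρ))
          (s-lock (strengthenO S s) (strengthenF σ f) (instantiateO m u))

  module Erasure (Holds : PredInterp) where
    open Typing Holds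

    mutual
      erase-sig : ∀ {Σs} → Σs sig → ValidSig Σs
      erase-sig S-empty          ()
      erase-sig (S-fam _ _)      (here ())
      erase-sig (S-fam d _)      (there p) = proj₂ (proj₂ (erase-kind d)) p
      erase-sig (S-obj d _)      (here refl) = proj₁ (erase-fam d)
      erase-sig (S-obj d _)      (there p) = proj₂ (proj₂ (erase-fam d)) p

      erase-ctx : ∀ {Σs Γ} → ⊢[ Σs ] Γ → Valid Σs Γ
      erase-ctx (C-empty s) = tt , erase-sig s
      erase-ctx (C-ext d)   = let (f , w , sg) = erase-fam d in (f , w) , sg

      erase-kind : ∀ {Σs Γ K} → Γ ⊢[ Σs ] K kind → sk* Γ ⊢ₛ K kind × Valid Σs Γ
      erase-kind (K-type c) = s-type , erase-ctx c
      erase-kind (K-Π d)    = let (k , (f , w) , sg) = erase-kind d in s-Πk f refl k , w , sg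

      erase-fam : ∀ {Σs Γ σ K} → Γ ⊢[ Σs ] σ ∶ K → sk* Γ ⊢ₛ σ fam × Valid Σs Γ
      erase-fam (F-const c _)  = s-fcst , erase-ctx c
      erase-fam (F-Π d)        = let (t , (f , w) , sg) = erase-fam d in s-Π f refl t , w , sg
      erase-fam (F-app d n)    =
        let (f , v) = erase-fam d in s-fapp f (proj₁ (erase-obj n)) , v
      erase-fam (F-lock d n)   =
        let (r , v) = erase-fam d ; (o , f , _) = erase-obj n in s-lockF o f r , v
      erase-fam (F-conv d _ _) = erase-fam d
      erase-fam (F-guarded-unlock d n _ _) =
        let (o , f , v) = erase-obj n in
        guarded-fam (proj₁ (erase-fam d)) (unlock-typed o f) , v

      erase-obj : ∀ {Σs Γ M σ} → Γ ⊢[ Σs ] M ⦂ σ →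
                  sk* Γ ⊢ₛ M ⦂ sk σ × sk* Γ ⊢ₛ σ fam × Valid Σs Γ
      erase-obj (O-const c m) = let (w , sg) = erase-ctx c in s-cst , closedF (sg m) , w , sg
      erase-obj (O-var c x)   =
        let (w , sg) = erase-ctx c ; (l , f) = erase-var w x in s-var l , f , w , sg
      erase-obj (O-abs d)     =
        let (m , t , (f , w) , sg) = erase-obj d in s-lam f refl m , s-Π f refl t , w , sg
      erase-obj (O-app {τ = τ} {N = N} d n) =
        let (m , f , v) = erase-obj d ; (o , _) = erase-obj n in
        subst (_ ⊢ₛ _ ⦂_) (sym (sk-sub (single N) τ)) (s-app m o) , instantiateF (Π-inv f) o , v
      erase-obj (O-conv d t e) =
        let (m , _ , v) = erase-obj d in subst (_ ⊢ₛ _ ⦂_) (sk-conv e) m , proj₁ (erase-fam t) , v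
      erase-obj (O-lock d n)  =
        let (m , r , v) = erase-obj d ; (o , f , _) = erase-obj n in
        s-lock o f m , s-lockF o f r , v
      erase-obj (O-top-unlock d _) =
        let (m , f , v) = erase-obj d in unlock-typed m f , lockF-body f , v
      erase-obj (O-guarded-unlock {ρ = ρ} d n _ _) =
        let (m , f , _) = erase-obj d ; (o , g , v) = erase-obj n ; u = unlock-typed o g in
        guarded-obj {ρ = ρ} m u , guarded-fam f u , v

  -- Strong normalisation is preserved by the congruence constructors
  -- (which create no redex at the root).

  SN-Π : ∀ {σ τ} → SNF σ → SNF τ → SNF (Π σ τ)
  SN-Π a@(acc ra) b@(acc rb) = acc λ { (Π₁ r) → SN-Π (ra r) b ; (Π₂ r) → SN-Π a (rb r) }

  SN-fapp : ∀ {σ N} → SNF σ → SNO N → SNF (fapp σ N)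
  SN-fapp a@(acc ra) b@(acc rb) =
    acc λ { (fapp₁ r) → SN-fapp (ra r) b ; (fapp₂ r) → SN-fapp a (rb r) }

  SN-lockF : ∀ {P N σ ρ} → SNO N → SNF σ → SNF ρ → SNF (lockF P N σ ρ)
  SN-lockF a@(acc ra) b@(acc rb) c@(acc rc) = acc λ
    { (lockF₁ r) → SN-lockF (ra r) b c
    ; (lockF₂ r) → SN-lockF a (rb r) c
    ; (lockF₃ r) → SN-lockF a b (rc r) }

  SN-Πk : ∀ {σ K} → SNF σ → SNK K → SNK (Πk σ K)
  SN-Πk a@(acc ra) b@(acc rb) = acc λ { (Πk₁ r) → SN-Πk (ra r) b ; (Πk₂ r) → SN-Πk a (rb r) }

  SN-lock : ∀ {P N σ M} → SNO N → SNF σ → SNO M → SNO (lock P N σ M)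
  SN-lock a@(acc ra) b@(acc rb) c@(acc rc) = acc λ
    { (lock₁ r) → SN-lock (ra r) b c
    ; (lock₂ r) → SN-lock a (rb r) c
    ; (lock₃ r) → SN-lock a b (rc r) }

  -- At L A an object must be SN and every unlock of it, with
  -- any predicate label and SN annotations, must be reducible at A: the
  -- typing rules may unlock it with annotations unrelated to its own lock.

  Red : Ty → Obj → Set
  Red ι       M = SNO M
  Red (A ⇒ B) M = ∀ N → Red A N → Red B (oapp M N)
  Red (L A)   M = SNO M × (∀ P N σ → SNO N → SNF σ → Red A (unlock P N σ M))

  -- Neutral objects create no redex when applied or unlocked.
  Neutral : Obj → Set
  Neutral (lam _ _)      = ⊥
  Neutral (lock _ _ _ _) = ⊥
  Neutral _              = ⊤

  -- Girard's conditions CR1 (reducible ⇒ SN), CR2 (closure under reduction)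
  -- and CR3 (a neutral object whose reducts are reducible is reducible).
  -- CR3 at A ⇒ B and L A is an inner induction on the SN argument/annotations.
  mutual
    Red⇒SN : ∀ A {M} → Red A M → SNO M
    Red⇒SN ι       r = r
    Red⇒SN (A ⇒ B) r = SN-pullback (λ X → oapp X (ocst 0)) oapp₁ (Red⇒SN B (r (ocst 0) (Red-cst A)))
    Red⇒SN (L A)   r = proj₁ r

    Red-⟶ : ∀ A {M M'} → Red A M → M ⟶O M' → Red A M'
    Red-⟶ ι       (acc rs) st = rs st
    Red-⟶ (A ⇒ B) r        st = λ N rN → Red-⟶ B (r N rN) (oapp₁ st)
    Red-⟶ (L A)   (acc rs , r) st = rs st , λ P N σ sN sσ → Red-⟶ A (r P N σ sN sσ) (unlock₃ st)

    Red-neutral : ∀ A {M} → Neutral M → (∀ {M'} → M ⟶O M' → Red A M') → Red A M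
    Red-neutral ι       ne h = acc h
    Red-neutral (A ⇒ B) ne h = λ N rN → Red-neutral-app A B ne h rN (Red⇒SN A rN)
    Red-neutral (L A)   ne h = acc (proj₁ ∘ h) , λ P N σ sN sσ → Red-neutral-unlock A ne h sN sσ

    Red-cst : ∀ A {c} → Red A (ocst c)
    Red-cst A = Red-neutral A tt (λ ())

    Red-neutral-app : ∀ A B {M N} → Neutral M → (∀ {M'} → M ⟶O M' → Red (A ⇒ B) M') →
                      Red A N → SNO N → Red B (oapp M N)
    Red-neutral-app A B ne h rN sN = Red-neutral B tt (reducts ne h rN sN)
      where
      reducts : ∀ {M N X} → Neutral M → (∀ {M'} → M ⟶O M' → Red (A ⇒ B) M') →
                Red A N → SNO N → oapp M N ⟶O X → Red B X
      reducts () h rN sN β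
      reducts ne h rN sN        (oapp₁ r) = h r _ rN
      reducts ne h rN (acc sN) (oapp₂ r) = Red-neutral-app A B ne h (Red-⟶ A rN r) (sN r)

    Red-neutral-unlock : ∀ A {P N σ M} → Neutral M → (∀ {M'} → M ⟶O M' → Red (L A) M') →
                         SNO N → SNF σ → Red A (unlock P N σ M)
    Red-neutral-unlock A ne h sN sσ = Red-neutral A tt (reducts ne h sN sσ)
      where
      reducts : ∀ {P N σ M X} → Neutral M → (∀ {M'} → M ⟶O M' → Red (L A) M') →
                SNO N → SNF σ → unlock P N σ M ⟶O X → Red A X
      reducts ne h (acc a) sσ      (unlock₁ r) = Red-neutral-unlock A ne h (a r) sσ
      reducts ne h sN      (acc b) (unlock₂ r) = Red-neutral-unlock A ne h sN (b r)
      reducts ne h sN      sσ      (unlock₃ r) = proj₂ (h r) _ _ _ sN sσ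
      reducts () h sN      sσ      βL

  Red-var : ∀ A {i} → Red A (var i)
  Red-var A = Red-neutral A tt (λ ())

  -- A lock with SN annotations around a reducible body is reducible: any
  -- unlock of it either fires βL (giving the body) or reduces inside.
  Red-lock : ∀ A {P N σ M} → Red A M → SNO N → SNF σ → Red (L A) (lock P N σ M)
  Red-lock A rM sN sσ =
    SN-lock sN sσ (Red⇒SN A rM) , λ P' N' σ' sN' sσ' → unlocked rM sN sσ (Red⇒SN A rM) sN' sσ'
    where
    mutual
      unlocked : ∀ {P N σ M P' N' σ'} → Red A M → SNO N → SNF σ → SNO M → SNO N' → SNF σ' →
                 Red A (unlock P' N' σ' (lock P N σ M))
      unlocked rM sN sσ sM sN' sσ' = Red-neutral A tt (reducts rM sN sσ sM sN' sσ')

      reducts : ∀ {P N σ M P' N' σ' X} → Red A M → SNO N → SNF σ → SNO M → SNO N' → SNF σ' →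
                unlock P' N' σ' (lock P N σ M) ⟶O X → Red A X
      reducts rM sN sσ sM (acc a) sσ' (unlock₁ r) = unlocked rM sN sσ sM (a r) sσ'
      reducts rM sN sσ sM sN' (acc a) (unlock₂ r) = unlocked rM sN sσ sM sN' (a r)
      reducts rM (acc a) sσ sM sN' sσ' (unlock₃ (lock₁ r)) = unlocked rM (a r) sσ sM sN' sσ'
      reducts rM sN (acc a) sM sN' sσ' (unlock₃ (lock₂ r)) = unlocked rM sN (a r) sM sN' sσ'
      reducts rM sN sσ (acc a) sN' sσ' (unlock₃ (lock₃ r)) =
        unlocked (Red-⟶ A rM r) sN sσ (a r) sN' sσ'
      reducts rM sN sσ sM sN' sσ' βL = rM

  Red-lam : ∀ A B {σ M} → SNF σ → SNO M → (∀ N → Red A N → Red B (M [ N ]O)) →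
            Red (A ⇒ B) (lam σ M)
  Red-lam A B sσ sM h N rN = applied sσ sM h rN (Red⇒SN A rN)
    where
    mutual
      applied : ∀ {σ M N} → SNF σ → SNO M → (∀ N → Red A N → Red B (M [ N ]O)) →
                Red A N → SNO N → Red B (oapp (lam σ M) N)
      applied sσ sM h rN sN = Red-neutral B tt (reducts sσ sM h rN sN)

      reducts : ∀ {σ M N X} → SNF σ → SNO M → (∀ N → Red A N → Red B (M [ N ]O)) →
                Red A N → SNO N → oapp (lam σ M) N ⟶O X → Red B X
      reducts sσ sM h rN sN β = h _ rN
      reducts (acc a) sM h rN sN (oapp₁ (lam₁ r)) = applied (a r) sM h rN sN
      reducts sσ (acc a) h rN sN (oapp₁ (lam₂ r)) =
        applied sσ (a r) (λ N' rN' → Red-⟶ B (h N' rN') (sub-⟶O (single N') r)) rN sN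
      reducts sσ sM h rN (acc a) (oapp₂ r) = applied sσ sM h (Red-⟶ A rN r) (a r)

  RedSub : Subst → List Ty → Set
  RedSub s Δ = ∀ {i A} → Δ ∋ₜ i ⦂ A → Red A (s i)

  RedSub-• : ∀ {s Δ N A} → Red A N → RedSub s Δ → RedSub (N • s) (A ∷ Δ)
  RedSub-• rN rs hd     = rN
  RedSub-• rN rs (tl x) = rs x

  SN-bodyK : ∀ s K → SNK (subK (ocst 0 • s) K) → SNK (subK (exts s) K)
  SN-bodyK s K h = SN-pullback (_[ ocst 0 ]K) (sub-⟶K _) (subst SNK (sym (single-extsK _ s K)) h)

  SN-bodyF : ∀ s τ → SNF (subF (ocst 0 • s) τ) → SNF (subF (exts s) τ)
  SN-bodyF s τ h = SN-pullback (_[ ocst 0 ]F) (sub-⟶F _) (subst SNF (sym (single-extsF _ s τ)) h)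

  SN-bodyO : ∀ s M → SNO (subO (ocst 0 • s) M) → SNO (subO (exts s) M)
  SN-bodyO s M h = SN-pullback (_[ ocst 0 ]O) (sub-⟶O _) (subst SNO (sym (single-extsO _ s M)) h)

  mutual
    fundamentalO : ∀ {Δ M A s} → Δ ⊢ₛ M ⦂ A → RedSub s Δ → Red A (subO s M)
    fundamentalO s-cst     rs = Red-cst _
    fundamentalO (s-var x) rs = rs x
    fundamentalO {s = s} (s-lam {M = M} {A = A} {B = B} f _ m) rs =
      Red-lam A B (fundamentalF f rs) (SN-bodyO s M (Red⇒SN B (fundamentalO m (RedSub-• (Red-cst A) rs)))) body
      where
      body : ∀ N → Red A N → Red B (subO (exts s) M [ N ]O)
      body N rN = subst (Red B) (sym (single-extsO N s M)) (fundamentalO m (RedSub-• rN rs))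
    fundamentalO (s-app m n) rs = fundamentalO m rs _ (fundamentalO n rs)
    fundamentalO (s-lock {A = A} {C = C} n f m) rs =
      Red-lock A (fundamentalO m rs) (Red⇒SN C (fundamentalO n rs)) (fundamentalF f rs)
    fundamentalO (s-unlock {P = P} {C = C} n f m) rs =
      proj₂ (fundamentalO m rs) P _ _ (Red⇒SN C (fundamentalO n rs)) (fundamentalF f rs)

    fundamentalF : ∀ {Δ σ s} → Δ ⊢ₛ σ fam → RedSub s Δ → SNF (subF s σ)
    fundamentalF s-fcst rs = acc λ ()
    fundamentalF {s = s} (s-Π {τ = τ} {A = A} f _ t) rs =
      SN-Π (fundamentalF f rs) (SN-bodyF s τ (fundamentalF t (RedSub-• (Red-cst A) rs)))
    fundamentalF (s-fapp {C = C} f n) rs =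
      SN-fapp (fundamentalF f rs) (Red⇒SN C (fundamentalO n rs))
    fundamentalF (s-lockF {C = C} n f g) rs =
      SN-lockF (Red⇒SN C (fundamentalO n rs)) (fundamentalF f rs) (fundamentalF g rs)

  fundamentalK : ∀ {Δ K s} → Δ ⊢ₛ K kind → RedSub s Δ → SNK (subK s K)
  fundamentalK s-type rs = acc λ ()
  fundamentalK {s = s} (s-Πk {K = K} {A = A} f _ k) rs =
    SN-Πk (fundamentalF f rs) (SN-bodyK s K (fundamentalK k (RedSub-• (Red-cst A) rs)))

  RedSub-id : ∀ {Δ} → RedSub var Δ
  RedSub-id {A = A} _ = Red-var A

  module StrongNormalisation (Holds : PredInterp) where
    open Typing Holds
    open Erasure Holds

    kind-SN : ∀ {Σs Γ K} → Γ ⊢[ Σs ] K kind → SNK K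
    kind-SN {K = K} d = subst SNK (sub-idK K) (fundamentalK (proj₁ (erase-kind d)) RedSub-id)

    family-SN : ∀ {Σs Γ σ K} → Γ ⊢[ Σs ] σ ∶ K → SNF σ
    family-SN {σ = σ} d = subst SNF (sub-idF σ) (fundamentalF (proj₁ (erase-fam d)) RedSub-id)

    object-SN : ∀ {Σs Γ M σ} → Γ ⊢[ Σs ] M ⦂ σ → SNO M
    object-SN {M = M} {σ} d =
      subst SNO (sub-idO M) (Red⇒SN (sk σ) (fundamentalO (proj₁ (erase-obj d)) RedSub-id))

theorem4p2 : (Pred : Set) (Holds : LLFP.PredInterp Pred) →
    let open LLFP Pred in
    let open Typing Holds in
    (∀ {Σs Γ K} → Γ ⊢[ Σs ] K kind → SNK K) ×
    (∀ {Σs Γ σ K} → Γ ⊢[ Σs ] σ ∶ K → SNF σ) ×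
    (∀ {Σs Γ M σ} → Γ ⊢[ Σs ] M ⦂ σ → SNO M)
theorem4p2 Pred Holds = kind-SN , family-SN , object-SN
  where open Normalisation.StrongNormalisation Pred Holds
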